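{- Let $H$ be a connected graph with minimum degree $\delta(H)=1$. Then $\mathrm{rsat}(n,H)=O(n)$.
   Context: An edge-coloured graph is a pair $(G,c)$ where $c$ is a (not necessarily proper) colouring of $E(G)$ with colours from $\mathbb{N}$. A subgraph is rainbow if all its edges receive distinct colours. An edge-coloured graph is $H$-rainbow saturated if it contains no rainbow copy of $H$, but adding any non-edge in any colour from $\mathbb{N}$ creates a rainbow copy of $H$. $\mathrm{rsat}(n,H)$ is the minimum number of edges in an $H$-rainbow saturated edge-coloured graph on $n$ vertices; $O(n)$ is as $n\to\infty$ with $H$ fixed. -}

module Defs where

open import Data.Nat using (ℕ; zero; suc; _+_; _*_; _≤_; _<?_)
open import Data.Fin using (Fin; zero; suc; toℕ; _≟_)
open import Data.Bool using (Bool; true; false; _∧_; _∨_; if_then_else_)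
open import Data.Maybe using (Maybe; just; nothing; is-just)
open import Data.Product using (Σ; _×_; _,_; ∃)
open import Data.Empty using (⊥-elim)
open import Data.Sum using (_⊎_)
open import Relation.Nullary using (¬_; Dec; yes; no; does)
open import Relation.Binary.PropositionalEquality using (_≡_; _≢_; refl)
open import Function.Definitions using (Injective)

count : ∀ {n} → (Fin n → Bool) → ℕ
count {zero}  p = 0
count {suc n} p = (if p zero then 1 else 0) + count (λ i → p (suc i))

record SimpleGraph (h : ℕ) : Set where
  field
    adj   : Fin h → Fin h → Bool
    sym   : ∀ u v → adj u v ≡ adj v u
    irrefl : ∀ v → adj v v ≡ false
open SimpleGraph public

degree : ∀ {h} → SimpleGraph h → Fin h → ℕ
degree H v = count (adj H v)

data Walk {h} (H : SimpleGraph h) : Fin h → Fin h → Set where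
  here : ∀ {u} → Walk H u u
  step : ∀ {u w v} → adj H u w ≡ true → Walk H w v → Walk H u v

Connected : ∀ {h} → SimpleGraph h → Set
Connected H = ∀ u v → Walk H u v

MinDegreeOne : ∀ {h} → SimpleGraph h → Set
MinDegreeOne H = (∀ v → 1 ≤ degree H v) × (∃ λ v → degree H v ≡ 1)

-- Edge-coloured simple graphs on vertex set Fin n:
-- col u v = just c  iff uv is an edge, with colour c

record ColouredGraph (n : ℕ) : Set where
  field
    col    : Fin n → Fin n → Maybe ℕ
    sym    : ∀ u v → col u v ≡ col v u
    irrefl : ∀ v → col v v ≡ nothing
open ColouredGraph public

sumFin : ∀ {n} → (Fin n → ℕ) → ℕ
sumFin {zero}  f = 0
sumFin {suc n} f = f zero + sumFin (λ i → f (suc i))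

numEdges : ∀ {n} → ColouredGraph n → ℕ
numEdges G = sumFin λ i → count λ j → does (toℕ i <? toℕ j) ∧ is-just (col G i j)

record RainbowCopy {h n} (H : SimpleGraph h) (G : ColouredGraph n) : Set where
  field
    φ        : Fin h → Fin n
    φ-inj    : Injective _≡_ _≡_ φ
    edges    : ∀ u v → adj H u v ≡ true → ∃ λ c → col G (φ u) (φ v) ≡ just c
    rainbow  : ∀ u v u′ v′ c → adj H u v ≡ true → adj H u′ v′ ≡ true →
               col G (φ u) (φ v) ≡ just c → col G (φ u′) (φ v′) ≡ just c →
               (u ≡ u′ × v ≡ v′) ⊎ (u ≡ v′ × v ≡ u′)

addEdgeCol : ∀ {n} → ColouredGraph n → Fin n → Fin n → ℕ → Fin n → Fin n → Maybe ℕ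
addEdgeCol G x y k i j =
  if (does (i ≟ x) ∧ does (j ≟ y)) ∨ (does (i ≟ y) ∧ does (j ≟ x))
  then just k else col G i j

addEdge : ∀ {n} (G : ColouredGraph n) (x y : Fin n) → x ≢ y → ℕ → ColouredGraph n
addEdge G x y x≢y k = record
  { col = addEdgeCol G x y k
  ; sym = symP
  ; irrefl = irr }
  where
    symP : ∀ u v → addEdgeCol G x y k u v ≡ addEdgeCol G x y k v u
    symP u v with u ≟ x | v ≟ y | u ≟ y | v ≟ x
    ... | yes _ | yes _ | yes _ | yes _ = refl
    ... | yes _ | yes _ | yes _ | no  _ = refl
    ... | yes _ | yes _ | no  _ | yes _ = refl
    ... | yes _ | yes _ | no  _ | no  _ = refl
    ... | yes _ | no  _ | yes _ | yes _ = refl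
    ... | yes _ | no  _ | yes _ | no  _ = sym G u v
    ... | yes _ | no  _ | no  _ | yes _ = sym G u v
    ... | yes _ | no  _ | no  _ | no  _ = sym G u v
    ... | no  _ | yes _ | yes _ | yes _ = refl
    ... | no  _ | yes _ | yes _ | no  _ = sym G u v
    ... | no  _ | yes _ | no  _ | yes _ = sym G u v
    ... | no  _ | yes _ | no  _ | no  _ = sym G u v
    ... | no  _ | no  _ | yes _ | yes _ = refl
    ... | no  _ | no  _ | yes _ | no  _ = sym G u v
    ... | no  _ | no  _ | no  _ | yes _ = sym G u v
    ... | no  _ | no  _ | no  _ | no  _ = sym G u v
    irr : ∀ v → addEdgeCol G x y k v v ≡ nothing
    irr v with v ≟ x | v ≟ y
    ... | yes refl | yes refl = ⊥-elim (x≢y refl)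
    ... | yes _    | no  _    = irrefl G v
    ... | no  _    | yes _    = irrefl G v
    ... | no  _    | no  _    = irrefl G v

RainbowSaturated : ∀ {h n} → SimpleGraph h → ColouredGraph n → Set
RainbowSaturated H G =
  ¬ RainbowCopy H G ×
  (∀ x y (x≢y : x ≢ y) → col G x y ≡ nothing → ∀ k → RainbowCopy H (addEdge G x y x≢y k))

RsatLinear : ∀ {h} → SimpleGraph h → Set
RsatLinear H = Σ ℕ λ C → Σ ℕ λ N → ∀ n → N ≤ n →
  Σ (ColouredGraph n) λ G → RainbowSaturated H G × numEdges G ≤ C * n

{-# OPTIONS --safe #-}
-- Let ℓ be a leaf of H with neighbour p, and call the edges of H - ℓ inner. Give the vertices
-- offsets 2^e(v) - 1 with e injective and e(p) = 0, so that distinct pairs of vertices have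
-- distinct offset differences. Cut 0, …, n - 1 into blocks of between M and 2M consecutive
-- vertices, M = 2^(|H| + 1), and make each block a clique, colouring the edge ij by its block
-- together with an inner edge ab, chosen with |offset a - offset b| = |i - j| whenever
-- possible. A rainbow copy of H lies in one block (H is connected), so its colours would
-- inject the edges of H into the inner edges, which miss ℓp: there is none. Unless H is a
-- single edge, a missing edge xy joins two blocks; sending p to the endpoint whose block
-- differs from that of the new colour, ℓ to the other endpoint and every other vertex to its
-- offset from p inside that block gives a rainbow copy, because distinct inner edges realise
-- distinct differences. Each vertex has fewer than 2M later neighbours, so there are O(n)
-- edges.
module Submission where

open import Data.Nat using (ℕ; zero; suc; pred; NonZero; _+_; _*_; _∸_; _^_; _≤_; _<_; z≤n; s≤s; ∣_-_∣;
                            _≤?_; _<?_; _<ᵇ_)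
  renaming (_≟_ to _≟ℕ_)
open import Data.Nat.Properties hiding (_≟_)
open import Data.Nat.DivMod
open import Algebra.Properties.CommutativeSemigroup +-commutativeSemigroup using (xy∙z≈xz∙y)
open import Data.Fin using (Fin; zero; suc; toℕ; fromℕ<; _≟_; combine)
open import Data.Fin.Properties using (toℕ-injective; toℕ-fromℕ<; toℕ<n; any?; pigeonhole; combine-injective)
open import Data.Bool using (Bool; true; false; T; _∧_)
  renaming (_≟_ to _≟B_)
open import Data.Bool.Properties using (∧-zeroʳ)
open import Data.Maybe using (Maybe; just; nothing; fromMaybe; is-just)
  renaming (map to mapMaybe)
open import Data.Maybe.Properties using (just-injective)
open import Data.Product using (_×_; _,_; ∃; ∃₂; proj₁; proj₂; uncurry)
open import Data.Sum using (_⊎_; inj₁; inj₂)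
open import Data.Empty using (⊥; ⊥-elim)
open import Function using (_∘_)
open import Function.Definitions using (Injective)
open import Relation.Binary using (tri<; tri≈; tri>)
open import Relation.Binary.PropositionalEquality
open import Relation.Nullary using (¬_; Dec; yes; no; does)
open import Relation.Nullary.Decidable using (¬?; _×-dec_; dec-true; dec-false)
open import Relation.Nullary.Negation using (contradiction)
open import Defs hiding (sym; irrefl)

private
  window-pred : ∀ {a b t} → a ≤ suc t × suc t < b → pred a ≤ t × t < pred b
  window-pred (a≤1+t , 1+t<b) = pred-mono-≤ a≤1+t , pred-mono-≤ 1+t<b

  pred∸pred≤∸ : ∀ a b → pred b ∸ pred a ≤ b ∸ a
  pred∸pred≤∸ zero    b       = pred[n]≤n
  pred∸pred≤∸ (suc a) zero    = ≤-reflexive (0∸n≡0 a)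
  pred∸pred≤∸ (suc a) (suc b) = ≤-refl

  window-at-0 : ∀ {a b c} → a ≤ 0 × 0 < b → c ≤ pred b ∸ pred a → suc c ≤ b ∸ a
  window-at-0 (z≤n , s≤s _) c≤ = s≤s c≤

count-≤-∸ : ∀ {n} a b (P : Fin n → Bool) →
            (∀ j → P j ≡ true → a ≤ toℕ j × toℕ j < b) → count P ≤ b ∸ a
count-≤-∸ {zero}  a b P inside = z≤n
count-≤-∸ {suc n} a b P inside
  with P zero in P0 | count-≤-∸ (pred a) (pred b) (P ∘ suc) (λ j → window-pred ∘ inside (suc j))
... | true  | rest = window-at-0 (inside zero P0) rest
... | false | rest = ≤-trans rest (pred∸pred≤∸ a b)

count≡0⇒false : ∀ {n} (P : Fin n → Bool) → count P ≡ 0 → ∀ j → P j ≡ false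
count≡0⇒false {suc n} P count≡0 j with P zero in P0
count≡0⇒false {suc n} P count≡0 zero    | false = P0
count≡0⇒false {suc n} P count≡0 (suc j) | false = count≡0⇒false (P ∘ suc) count≡0 j

count≡1⇒unique : ∀ {n} (P : Fin n → Bool) → count P ≡ 1 →
                 ∃ λ i → P i ≡ true × (∀ j → P j ≡ true → j ≡ i)
count≡1⇒unique {suc n} P count≡1 with P zero in P0
... | true  = zero , P0 , only-zero
  where
  only-zero : ∀ j → P j ≡ true → j ≡ zero
  only-zero zero    _  = refl
  only-zero (suc j) Pj with () ← trans (sym Pj) (count≡0⇒false (P ∘ suc) (suc-injective count≡1) j)
... | false with i , Pi , unique ← count≡1⇒unique (P ∘ suc) count≡1 = suc i , Pi , only-suc-i
  where
  only-suc-i : ∀ j → P j ≡ true → j ≡ suc i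
  only-suc-i zero    Pz with () ← trans (sym Pz) P0
  only-suc-i (suc j) Pj = cong suc (unique j Pj)

sumFin-≤-* : ∀ {n} (f : Fin n → ℕ) c → (∀ i → f i ≤ c) → sumFin f ≤ c * n
sumFin-≤-* {zero}  f c f≤c = z≤n
sumFin-≤-* {suc n} f c f≤c = begin
  f zero + sumFin (f ∘ suc) ≤⟨ +-mono-≤ (f≤c zero) (sumFin-≤-* (f ∘ suc) c (f≤c ∘ suc)) ⟩
  c + c * n                 ≡⟨ *-suc c n ⟨
  c * suc n                 ∎
  where open ≤-Reasoning

combine-injective₂ : ∀ {m n} → Injective _≡_ _≡_ (uncurry (combine {m} {n}))
combine-injective₂ {x = a , b} {c , d} eq with refl , refl ← combine-injective a b c d eq = refl

module _ {A : Set} {m : ℕ} (enc : A → Fin m) (enc-injective : Injective _≡_ _≡_ enc) where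

  dedekind-finite : (P : A → Set) (f : A → A) → (∀ {a} → P a → P (f a)) →
                    (∀ {a b} → P a → P b → f a ≡ f b → a ≡ b) →
                    ∀ {x} → P x → (∀ {a} → P a → f a ≢ x) → ⊥
  dedekind-finite P f f-preserves f-injective {x} Px f-misses-x =
    let i , j , i<j , same = pigeonhole (n<1+n m) (enc ∘ orbit ∘ toℕ)
    in orbit-never-returns (toℕ i) (toℕ j ∸ suc (toℕ i)) (begin
      orbit (toℕ i)                               ≡⟨ enc-injective same ⟩
      orbit (toℕ j)                               ≡⟨ cong orbit (m+[n∸m]≡n i<j) ⟨
      orbit (suc (toℕ i) + (toℕ j ∸ suc (toℕ i))) ≡⟨ cong orbit (+-suc (toℕ i) _) ⟨
      orbit (toℕ i + suc (toℕ j ∸ suc (toℕ i)))   ∎)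
    where
    open ≡-Reasoning
    orbit : ℕ → A
    orbit zero    = x
    orbit (suc i) = f (orbit i)

    orbit-P : ∀ i → P (orbit i)
    orbit-P zero    = Px
    orbit-P (suc i) = f-preserves (orbit-P i)

    orbit-never-returns : ∀ i k → orbit i ≢ orbit (i + suc k)
    orbit-never-returns zero    k eq = f-misses-x (orbit-P k) (sym eq)
    orbit-never-returns (suc i) k eq =
      orbit-never-returns i k (f-injective (orbit-P i) (orbit-P (i + suc k)) eq)

SamePair : ∀ {A : Set} → A → A → A → A → Set
SamePair a b c d = (a ≡ c × b ≡ d) ⊎ (a ≡ d × b ≡ c)

SamePair-swapˡ : ∀ {A : Set} {a b c d : A} → SamePair a b c d → SamePair b a c d
SamePair-swapˡ (inj₁ (a≡c , b≡d)) = inj₂ (b≡d , a≡c)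
SamePair-swapˡ (inj₂ (a≡d , b≡c)) = inj₁ (b≡c , a≡d)

SamePair-map : ∀ {A B : Set} {f : A → B} → (∀ {a b} → f a ≡ f b → a ≡ b) →
               ∀ {a b c d} → SamePair (f a) (f b) (f c) (f d) → SamePair a b c d
SamePair-map f-inj (inj₁ (p , q)) = inj₁ (f-inj p , f-inj q)
SamePair-map f-inj (inj₂ (p , q)) = inj₂ (f-inj p , f-inj q)

SamePair-sym : ∀ {A : Set} {a b c d : A} → SamePair a b c d → SamePair c d a b
SamePair-sym (inj₁ (refl , refl)) = inj₁ (refl , refl)
SamePair-sym (inj₂ (refl , refl)) = inj₂ (refl , refl)

SamePair-trans : ∀ {A : Set} {a b c d e f : A} → SamePair a b c d → SamePair c d e f → SamePair a b e f
SamePair-trans (inj₁ (refl , refl)) q                    = q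
SamePair-trans (inj₂ (refl , refl)) (inj₁ (refl , refl)) = inj₂ (refl , refl)
SamePair-trans (inj₂ (refl , refl)) (inj₂ (refl , refl)) = inj₁ (refl , refl)

2^-injective : ∀ {a b} → 2 ^ a ≡ 2 ^ b → a ≡ b
2^-injective {a} {b} eq with <-cmp a b
... | tri< a<b _ _ = ⊥-elim (<-irrefl eq (^-monoʳ-< 2 (s≤s (s≤s z≤n)) a<b))
... | tri≈ _ a≡b _ = a≡b
... | tri> _ _ a>b = ⊥-elim (<-irrefl (sym eq) (^-monoʳ-< 2 (s≤s (s≤s z≤n)) a>b))

private
  ∣2^-2^∣≡ : ∀ {a b} → a < b → ∣ 2 ^ a - 2 ^ b ∣ ≡ 2 ^ b ∸ 2 ^ a
  ∣2^-2^∣≡ a<b = m≤n⇒∣m-n∣≡n∸m (^-monoʳ-≤ 2 (<⇒≤ a<b))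

  -- For a < b the difference 2^b - 2^a lies in [2^(b-1), 2^b), which pins down b.
  2^∸2^<2^∸2^ : ∀ {a b c d} → a < b → c < d → b < d → 2 ^ b ∸ 2 ^ a < 2 ^ d ∸ 2 ^ c
  2^∸2^<2^∸2^ {a} {b} {c} {suc d} a<b (s≤s c≤d) (s≤s b≤d) = begin-strict
    2 ^ b ∸ 2 ^ a           <⟨ ∸-monoʳ-< (m^n>0 2 a) (^-monoʳ-≤ 2 (<⇒≤ a<b)) ⟩
    2 ^ b                   ≤⟨ ^-monoʳ-≤ 2 b≤d ⟩
    2 ^ d                   ≡⟨ m+n∸n≡m (2 ^ d) (2 ^ d) ⟨
    2 ^ d + 2 ^ d ∸ 2 ^ d   ≤⟨ ∸-monoʳ-≤ (2 ^ d + 2 ^ d) (^-monoʳ-≤ 2 c≤d) ⟩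
    2 ^ d + 2 ^ d ∸ 2 ^ c   ≡⟨ cong (λ t → 2 ^ d + t ∸ 2 ^ c) (+-identityʳ (2 ^ d)) ⟨
    2 ^ suc d ∸ 2 ^ c       ∎
    where open ≤-Reasoning

  2^∸2^-injective : ∀ {a b c d} → a < b → c < d →
                    2 ^ b ∸ 2 ^ a ≡ 2 ^ d ∸ 2 ^ c → a ≡ c × b ≡ d
  2^∸2^-injective {a} {b} {c} {d} a<b c<d eq with <-cmp b d
  ... | tri< b<d _ _  = ⊥-elim (<-irrefl eq (2^∸2^<2^∸2^ a<b c<d b<d))
  ... | tri> _ _ d<b  = ⊥-elim (<-irrefl (sym eq) (2^∸2^<2^∸2^ c<d a<b d<b))
  ... | tri≈ _ refl _ =
    2^-injective (∸-cancelˡ-≡ (^-monoʳ-≤ 2 (<⇒≤ a<b)) (^-monoʳ-≤ 2 (<⇒≤ c<d)) eq) , refl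

  2^-sidon-< : ∀ {a b c d} → a < b → c < d →
               ∣ 2 ^ a - 2 ^ b ∣ ≡ ∣ 2 ^ c - 2 ^ d ∣ → a ≡ c × b ≡ d
  2^-sidon-< a<b c<d eq = 2^∸2^-injective a<b c<d (trans (sym (∣2^-2^∣≡ a<b)) (trans eq (∣2^-2^∣≡ c<d)))

2^-sidon : ∀ {a b c d} → a ≢ b → c ≢ d →
           ∣ 2 ^ a - 2 ^ b ∣ ≡ ∣ 2 ^ c - 2 ^ d ∣ → SamePair a b c d
2^-sidon {a} {b} {c} {d} a≢b c≢d eq with <-cmp a b | <-cmp c d
... | tri≈ _ a≡b _ | _            = ⊥-elim (a≢b a≡b)
... | _            | tri≈ _ c≡d _ = ⊥-elim (c≢d c≡d)
... | tri< a<b _ _ | tri< c<d _ _ = inj₁ (2^-sidon-< a<b c<d eq)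
... | tri< a<b _ _ | tri> _ _ d<c = inj₂ (2^-sidon-< a<b d<c (trans eq (∣-∣-comm (2 ^ c) _)))
... | tri> _ _ b<a | tri< c<d _ _ =
  SamePair-swapˡ (inj₁ (2^-sidon-< b<a c<d (trans (∣-∣-comm (2 ^ b) _) eq)))
... | tri> _ _ b<a | tri> _ _ d<c =
  SamePair-swapˡ (inj₂ (2^-sidon-< b<a d<c (trans (∣-∣-comm (2 ^ b) _) (trans eq (∣-∣-comm (2 ^ c) _)))))

∣m∸1-n∸1∣≡∣m-n∣ : ∀ {m n} → 0 < m → 0 < n → ∣ m ∸ 1 - n ∸ 1 ∣ ≡ ∣ m - n ∣
∣m∸1-n∸1∣≡∣m-n∣ {suc m} {suc n} _ _ = refl

private
  ∣o∸m-o∸n∣≡n∸m : ∀ {m n o} → m ≤ n → n ≤ o → ∣ o ∸ m - o ∸ n ∣ ≡ n ∸ m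
  ∣o∸m-o∸n∣≡n∸m {m} {n} {o} m≤n n≤o = begin
    ∣ o ∸ m - o ∸ n ∣               ≡⟨ cong (∣_- o ∸ n ∣) o∸m≡o∸n+[n∸m] ⟩
    ∣ (o ∸ n) + (n ∸ m) - o ∸ n ∣   ≡⟨ ∣-∣-comm ((o ∸ n) + (n ∸ m)) (o ∸ n) ⟩
    ∣ o ∸ n - (o ∸ n) + (n ∸ m) ∣   ≡⟨ ∣m-m+n∣≡n (o ∸ n) (n ∸ m) ⟩
    n ∸ m                           ∎
    where
    open ≡-Reasoning
    o∸m≡o∸n+[n∸m] : o ∸ m ≡ (o ∸ n) + (n ∸ m)
    o∸m≡o∸n+[n∸m] = trans (cong (_∸ m) (sym (m∸n+n≡m n≤o))) (+-∸-assoc (o ∸ n) m≤n)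

∣o∸m-o∸n∣≡∣m-n∣ : ∀ {m n o} → m ≤ o → n ≤ o → ∣ o ∸ m - o ∸ n ∣ ≡ ∣ m - n ∣
∣o∸m-o∸n∣≡∣m-n∣ {m} {n} {o} m≤o n≤o with ≤-total m n
... | inj₁ m≤n = trans (∣o∸m-o∸n∣≡n∸m m≤n n≤o) (sym (m≤n⇒∣m-n∣≡n∸m m≤n))
... | inj₂ n≤m = begin
  ∣ o ∸ m - o ∸ n ∣ ≡⟨ ∣-∣-comm (o ∸ m) (o ∸ n) ⟩
  ∣ o ∸ n - o ∸ m ∣ ≡⟨ ∣o∸m-o∸n∣≡n∸m n≤m m≤o ⟩
  m ∸ n             ≡⟨ m≤n⇒∣n-m∣≡n∸m n≤m ⟨
  ∣ m - n ∣         ∎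
  where open ≡-Reasoning

[m+kn]/n≡k : ∀ {m n} .{{_ : NonZero n}} k → m < n → (m + k * n) / n ≡ k
[m+kn]/n≡k {m} {n} k m<n = begin
  (m + k * n) / n       ≡⟨ +-distrib-/ m (k * n) rem-sum<n ⟩
  m / n + k * n / n     ≡⟨ cong₂ _+_ (m<n⇒m/n≡0 m<n) (m*n/n≡m k n) ⟩
  k                     ∎
  where
  open ≡-Reasoning
  rem-sum<n : m % n + k * n % n < n
  rem-sum<n = subst (_< n) (sym (trans (cong₂ _+_ (m<n⇒m%n≡m m<n) (m*n%n≡0 k n)) (+-identityʳ m))) m<n

module Blocks (D : ℕ) where

  M : ℕ
  M = suc D + suc D

  -- The first block also absorbs the n % M leftover vertices, so once M ≤ n every block
  -- holds between M and 2M - 1 of the vertices 0, …, n - 1.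
  module Partition (n : ℕ) where

    private
      r : ℕ
      r = n % M

    block : ℕ → ℕ
    block v = (v ∸ r) / M

    blocks : ℕ
    blocks = n / M

    position : ℕ → ℕ
    position v = (v ∸ r) % M

    private
      n∸r≡blocks*M : n ∸ r ≡ blocks * M
      n∸r≡blocks*M = trans (cong (_∸ r) (m≡m%n+[m/n]*n n M)) (m+n∸m≡n r (blocks * M))

      ∸r≡position+block*M : ∀ v → v ∸ r ≡ position v + block v * M
      ∸r≡position+block*M v = m≡m%n+[m/n]*n (v ∸ r) M

    block-mono : ∀ {v w} → v ≤ w → block v ≤ block w
    block-mono v≤w = /-monoˡ-≤ M (∸-monoˡ-≤ r v≤w)

    <⇒block<blocks : M ≤ n → ∀ {v} → v < n → block v < blocks
    <⇒block<blocks M≤n {v} v<n = m<n*o⇒m/o<n (subst (v ∸ r <_) n∸r≡blocks*M v∸r<n∸r)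
      where
      r<n : r < n
      r<n = <-≤-trans (m%n<n n M) M≤n
      v∸r<n∸r : v ∸ r < n ∸ r
      v∸r<n∸r with ≤-total r v
      ... | inj₁ r≤v = ∸-monoˡ-< v<n r≤v
      ... | inj₂ v≤r = subst (_< n ∸ r) (sym (m≤n⇒m∸n≡0 v≤r)) (m<n⇒0<n∸m r<n)

    block<blocks⇒< : ∀ {v} → block v < blocks → v < n
    block<blocks⇒< {v} bv<blocks with v <? n
    ... | yes v<n = v<n
    ... | no  v≮n = contradiction bv<blocks (≤⇒≯ (begin
      blocks              ≡⟨ m*n/n≡m blocks M ⟨
      blocks * M / M      ≡⟨ cong (_/ M) n∸r≡blocks*M ⟨
      (n ∸ r) / M         ≤⟨ /-monoˡ-≤ M (∸-monoˡ-≤ r (≮⇒≥ v≮n)) ⟩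
      block v             ∎))
      where open ≤-Reasoning

    block*M≤ : ∀ v → block v * M ≤ v
    block*M≤ v = ≤-trans (m/n*n≤m (v ∸ r) M) (m∸n≤m v r)

    block≡⇒< : ∀ {i j} → block i ≡ block j → j < (M + M) + i
    block≡⇒< {i} {j} same = begin-strict
      j                                 ≤⟨ m≤n+m∸n j r ⟩
      r + (j ∸ r)                       ≡⟨ cong (r +_) (∸r≡position+block*M j) ⟩
      r + (position j + block j * M)    <⟨ +-monoʳ-< r (+-monoˡ-< (block j * M) (m%n<n (j ∸ r) M)) ⟩
      r + (M + block j * M)             ≡⟨ cong (λ b → r + (M + b * M)) same ⟨
      r + (M + block i * M)             ≤⟨ +-mono-≤ (<⇒≤ (m%n<n n M)) (+-monoʳ-≤ M (block*M≤ i)) ⟩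
      M + (M + i)                       ≡⟨ +-assoc M M i ⟨
      (M + M) + i                       ∎
      where open ≤-Reasoning

    block-+ : ∀ {z t} → position z + t < M → block (z + t) ≡ block z
    block-+ {z} {t} fits = ≤-antisym (begin
      block (z + t)                        ≤⟨ /-monoˡ-≤ M z+t∸r≤z∸r+t ⟩
      ((z ∸ r) + t) / M                    ≡⟨ cong (λ x → (x + t) / M) (∸r≡position+block*M z) ⟩
      (position z + block z * M + t) / M   ≡⟨ cong (_/ M) (xy∙z≈xz∙y (position z) (block z * M) t) ⟩
      (position z + t + block z * M) / M   ≡⟨ [m+kn]/n≡k (block z) fits ⟩
      block z                              ∎) (block-mono (m≤m+n z t))
      where
      open ≤-Reasoning
      z+t∸r≤z∸r+t : (z + t) ∸ r ≤ (z ∸ r) + t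
      z+t∸r≤z∸r+t = m≤n+o⇒m∸n≤o (z + t) r
                      (≤-trans (+-monoˡ-≤ t (m≤n+m∸n z r)) (≤-reflexive (+-assoc r (z ∸ r) t)))

    block-∸ : ∀ {z t} → t ≤ position z → block (z ∸ t) ≡ block z
    block-∸ {z} {t} t≤position = begin
      ((z ∸ t) ∸ r) / M                    ≡⟨ cong (_/ M) z∸t∸r≡z∸r∸t ⟩
      ((z ∸ r) ∸ t) / M                    ≡⟨ cong (λ x → (x ∸ t) / M) (∸r≡position+block*M z) ⟩
      (position z + block z * M ∸ t) / M   ≡⟨ cong (_/ M) (+-∸-comm (block z * M) t≤position) ⟩
      (position z ∸ t + block z * M) / M   ≡⟨ [m+kn]/n≡k (block z) (≤-<-trans (m∸n≤m _ t) (m%n<n (z ∸ r) M)) ⟩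
      block z                              ∎
      where
      open ≡-Reasoning
      z∸t∸r≡z∸r∸t : (z ∸ t) ∸ r ≡ (z ∸ r) ∸ t
      z∸t∸r≡z∸r∸t = trans (∸-+-assoc z t r) (trans (cong (z ∸_) (+-comm t r)) (sym (∸-+-assoc z r t)))

    record Ray (z : ℕ) : Set where
      field
        point           : ℕ → ℕ
        point-0         : point 0 ≡ z
        point-<         : ∀ {t} → t ≤ D → point t < n
        point-block     : ∀ {t} → t ≤ D → block (point t) ≡ block z
        point-isometric : ∀ {s t} → s ≤ D → t ≤ D → ∣ point s - point t ∣ ≡ ∣ s - t ∣

    -- A block is at least 2(D + 1) long, so from z it extends by D upwards or downwards.
    ray : M ≤ n → ∀ {z} → z < n → Ray z
    ray M≤n {z} z<n with position z ≤? D
    ... | yes position≤D = record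
      { point           = z +_
      ; point-0         = +-identityʳ z
      ; point-<         = λ t≤D → block<blocks⇒< (subst (_< blocks) (sym (up-block t≤D)) z-in-range)
      ; point-block     = up-block
      ; point-isometric = λ _ _ → ∣m+n-m+o∣≡∣n-o∣ z _ _
      }
      where
      z-in-range : block z < blocks
      z-in-range = <⇒block<blocks M≤n z<n
      up-block : ∀ {t} → t ≤ D → block (z + t) ≡ block z
      up-block t≤D = block-+ (s≤s (≤-trans (+-mono-≤ position≤D t≤D) (+-monoʳ-≤ D (n≤1+n D))))
    ... | no position≰D = record
      { point           = z ∸_
      ; point-0         = refl
      ; point-<         = λ {t} _ → ≤-<-trans (m∸n≤m z t) z<n
      ; point-block     = λ t≤D → block-∸ (≤-below-position t≤D)
      ; point-isometric = λ s≤D t≤D → ∣o∸m-o∸n∣≡∣m-n∣ (≤-below-z s≤D) (≤-below-z t≤D)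
      }
      where
      ≤-below-position : ∀ {t} → t ≤ D → t ≤ position z
      ≤-below-position t≤D = ≤-trans t≤D (<⇒≤ (≰⇒> position≰D))
      ≤-below-z : ∀ {t} → t ≤ D → t ≤ z
      ≤-below-z t≤D = ≤-trans (≤-below-position t≤D) (≤-trans (m%n≤m (z ∸ r) M) (m∸n≤m z r))

module _ {n} (G : ColouredGraph n) {x y : Fin n} (x≢y : x ≢ y) (k : ℕ) where

  addEdge-new : col (addEdge G x y x≢y k) x y ≡ just k
  addEdge-new rewrite dec-true (x ≟ x) refl | dec-true (y ≟ y) refl = refl

  addEdge-awayˡ : ∀ {a b} → a ≢ x → b ≢ x → col (addEdge G x y x≢y k) a b ≡ col G a b
  addEdge-awayˡ {a} {b} a≢x b≢x
    rewrite dec-false (a ≟ x) a≢x | dec-false (b ≟ x) b≢x | ∧-zeroʳ (does (a ≟ y)) = refl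

  addEdge-awayʳ : ∀ {a b} → a ≢ y → b ≢ y → col (addEdge G x y x≢y k) a b ≡ col G a b
  addEdge-awayʳ {a} {b} a≢y b≢y
    rewrite dec-false (a ≟ y) a≢y | dec-false (b ≟ y) b≢y | ∧-zeroʳ (does (a ≟ x)) = refl

module Construction {h : ℕ} (H : SimpleGraph (suc h)) {ℓ p : Fin (suc h)}
                    (ℓp : adj H ℓ p ≡ true) (ℓ-leaf : ∀ v → adj H ℓ v ≡ true → v ≡ p) where

  Vertex : Set
  Vertex = Fin (suc h)

  adj-irrefl : ∀ {u v} → adj H u v ≡ true → u ≢ v
  adj-irrefl {u} uu refl with () ← trans (sym uu) (SimpleGraph.irrefl H u)

  adj-sym : ∀ {u v} → adj H u v ≡ true → adj H v u ≡ true
  adj-sym {u} {v} uv = trans (SimpleGraph.sym H v u) uv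

  p≢ℓ : p ≢ ℓ
  p≢ℓ p≡ℓ = adj-irrefl ℓp (sym p≡ℓ)

  exponent : Vertex → ℕ
  exponent v with v ≟ p
  ... | yes _ = 0
  ... | no  _ = suc (toℕ v)

  exponent-p : exponent p ≡ 0
  exponent-p with p ≟ p
  ... | yes _   = refl
  ... | no  p≢p = ⊥-elim (p≢p refl)

  exponent-injective : ∀ {u v} → exponent u ≡ exponent v → u ≡ v
  exponent-injective {u} {v} eq with u ≟ p | v ≟ p
  ... | yes u≡p | yes v≡p = trans u≡p (sym v≡p)
  ... | no  _   | no  _   = toℕ-injective (suc-injective eq)

  exponent-≤ : ∀ v → exponent v ≤ suc h
  exponent-≤ v with v ≟ p
  ... | yes _ = z≤n
  ... | no  _ = toℕ<n v

  -- A copy of H with p at z puts every vertex v ≢ ℓ at distance offset v from z.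
  offset : Vertex → ℕ
  offset v = 2 ^ exponent v ∸ 1

  D : ℕ
  D = 2 ^ suc h ∸ 1

  offset-p : offset p ≡ 0
  offset-p = cong (λ e → 2 ^ e ∸ 1) exponent-p

  offset-≤ : ∀ v → offset v ≤ D
  offset-≤ v = ∸-monoˡ-≤ 1 (^-monoʳ-≤ 2 (exponent-≤ v))

  ∣offset-offset∣ : ∀ u v → ∣ offset u - offset v ∣ ≡ ∣ 2 ^ exponent u - 2 ^ exponent v ∣
  ∣offset-offset∣ u v = ∣m∸1-n∸1∣≡∣m-n∣ (m^n>0 2 (exponent u)) (m^n>0 2 (exponent v))

  offset-sidon : ∀ {u v u′ v′} → u ≢ v → u′ ≢ v′ →
                 ∣ offset u - offset v ∣ ≡ ∣ offset u′ - offset v′ ∣ → SamePair u v u′ v′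
  offset-sidon {u} {v} {u′} {v′} u≢v u′≢v′ eq = SamePair-map exponent-injective
    (2^-sidon (u≢v ∘ exponent-injective) (u′≢v′ ∘ exponent-injective)
              (trans (sym (∣offset-offset∣ u v)) (trans eq (∣offset-offset∣ u′ v′))))

  offset-injective : ∀ {u v} → offset u ≡ offset v → u ≡ v
  offset-injective {u} {v} eq = exponent-injective (2^-injective (∣m-n∣≡0⇒m≡n (begin
    ∣ 2 ^ exponent u - 2 ^ exponent v ∣ ≡⟨ ∣offset-offset∣ u v ⟨
    ∣ offset u - offset v ∣             ≡⟨ cong (∣_- offset v ∣) eq ⟩
    ∣ offset v - offset v ∣             ≡⟨ ∣n-n∣≡0 (offset v) ⟩
    0                                   ∎)))
    where open ≡-Reasoning

  Edge : Vertex → Vertex → Set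
  Edge u v = toℕ u < toℕ v × adj H u v ≡ true

  InnerEdge : Vertex → Vertex → Set
  InnerEdge u v = Edge u v × u ≢ ℓ × v ≢ ℓ

  InnerEdge? : ∀ u v → Dec (InnerEdge u v)
  InnerEdge? u v = ((toℕ u <? toℕ v) ×-dec (adj H u v ≟B true)) ×-dec (¬? (u ≟ ℓ) ×-dec ¬? (v ≟ ℓ))

  Edge-SamePair⇒≡ : ∀ {u v u′ v′} → Edge u v → Edge u′ v′ → SamePair u v u′ v′ →
                    (u , v) ≡ (u′ , v′)
  Edge-SamePair⇒≡ _          _            (inj₁ (refl , refl)) = refl
  Edge-SamePair⇒≡ (u<v , _)  (v<u , _)    (inj₂ (refl , refl)) = ⊥-elim (<-asym u<v v<u)

  edge-sorted : ∀ {u v} → adj H u v ≡ true → Edge u v ⊎ Edge v u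
  edge-sorted {u} {v} uv with <-cmp (toℕ u) (toℕ v)
  ... | tri< u<v _ _ = inj₁ (u<v , uv)
  ... | tri≈ _ u≡v _ = ⊥-elim (adj-irrefl uv (toℕ-injective u≡v))
  ... | tri> _ _ v<u = inj₂ (v<u , adj-sym uv)

  HasInnerEdge : Set
  HasInnerEdge = ∃₂ InnerEdge

  hasInnerEdge? : Dec HasInnerEdge
  hasInnerEdge? = any? λ a → any? λ b → InnerEdge? a b

  ¬HasInnerEdge⇒ℓ-or-p : Connected H → ¬ HasInnerEdge → ∀ v → v ≡ ℓ ⊎ v ≡ p
  ¬HasInnerEdge⇒ℓ-or-p connected noInner v = walk (connected ℓ v) (inj₁ refl)
    where
    walk : ∀ {u v} → Walk H u v → u ≡ ℓ ⊎ u ≡ p → v ≡ ℓ ⊎ v ≡ p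
    walk here                     u∈ℓp         = u∈ℓp
    walk (step {w = w} ℓw rest)   (inj₁ refl)  = walk rest (inj₂ (ℓ-leaf w ℓw))
    walk (step {w = w} pw rest)   (inj₂ refl) with w ≟ ℓ
    ... | yes w≡ℓ = walk rest (inj₁ w≡ℓ)
    ... | no  w≢ℓ with edge-sorted pw
    ...   | inj₁ pw-edge = ⊥-elim (noInner (p , w , pw-edge , p≢ℓ , w≢ℓ))
    ...   | inj₂ wp-edge = ⊥-elim (noInner (w , p , wp-edge , w≢ℓ , p≢ℓ))

  Realised : ℕ → Set
  Realised d = ∃₂ λ a b → InnerEdge a b × ∣ offset a - offset b ∣ ≡ d

  realised? : ∀ d → Dec (Realised d)
  realised? d = any? λ a → any? λ b → InnerEdge? a b ×-dec (∣ offset a - offset b ∣ ≟ℕ d)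

  -- The fallback to an arbitrary inner edge makes every pair inside a block an edge.
  label : ℕ → Maybe (Vertex × Vertex)
  label d with realised? d | hasInnerEdge?
  ... | yes (a , b , _) | _                 = just (a , b)
  ... | no _            | yes (a , b , _)   = just (a , b)
  ... | no _            | no _              = nothing

  label-inner : ∀ d {a b} → label d ≡ just (a , b) → InnerEdge a b
  label-inner d eq with realised? d | hasInnerEdge?
  label-inner d refl | yes (_ , _ , ab , _) | _              = ab
  label-inner d refl | no _                 | yes (_ , _ , ab) = ab

  label-total : HasInnerEdge → ∀ d → ∃ λ ab → label d ≡ just ab
  label-total inner d with realised? d | hasInnerEdge?
  ... | yes (a , b , _) | _             = (a , b) , refl
  ... | no _            | yes (a , b , _) = (a , b) , refl
  ... | no _            | no noInner    = ⊥-elim (noInner inner)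

  label-realised : ∀ {u v} → u ≢ ℓ → v ≢ ℓ → adj H u v ≡ true →
                   ∃₂ λ a b → label ∣ offset u - offset v ∣ ≡ just (a , b) ×
                              ∣ offset a - offset b ∣ ≡ ∣ offset u - offset v ∣
  label-realised {u} {v} u≢ℓ v≢ℓ uv with realised? ∣ offset u - offset v ∣ | hasInnerEdge?
  ... | yes (a , b , _ , ab≡uv) | _ = a , b , refl , ab≡uv
  ... | no unrealised | _ with edge-sorted uv
  ...   | inj₁ uv-edge = ⊥-elim (unrealised (u , v , (uv-edge , u≢ℓ , v≢ℓ) , refl))
  ...   | inj₂ vu-edge =
    ⊥-elim (unrealised (v , u , (vu-edge , v≢ℓ , u≢ℓ) , ∣-∣-comm (offset v) (offset u)))

  B : ℕ
  B = suc h * suc h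

  code : ℕ → Vertex × Vertex → ℕ
  code c ab = toℕ (uncurry combine ab) + c * B

  code-block : ∀ c ab → code c ab / B ≡ c
  code-block c ab = [m+kn]/n≡k c (toℕ<n (uncurry combine ab))

  code-injective : ∀ c {ab cd} → code c ab ≡ code c cd → ab ≡ cd
  code-injective c eq = combine-injective₂ (toℕ-injective (+-cancelʳ-≡ (c * B) _ _ eq))

  open Blocks D

  module Graph (n : ℕ) where

    open Partition n

    blk : Fin n → ℕ
    blk i = block (toℕ i)

    colour : Fin n → Fin n → Maybe ℕ
    colour i j with blk i ≟ℕ blk j | i ≟ j
    ... | yes _ | no _  = mapMaybe (code (blk i)) (label ∣ toℕ i - toℕ j ∣)
    ... | yes _ | yes _ = nothing
    ... | no _  | _     = nothing

    colour-sym : ∀ i j → colour i j ≡ colour j i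
    colour-sym i j with blk i ≟ℕ blk j | i ≟ j | blk j ≟ℕ blk i | j ≟ i
    ... | yes ij | no _    | yes _  | no _    rewrite ij | ∣-∣-comm (toℕ i) (toℕ j) = refl
    ... | yes _  | yes _   | yes _  | yes _   = refl
    ... | yes _  | yes i≡j | yes _  | no j≢i  = ⊥-elim (j≢i (sym i≡j))
    ... | yes _  | no i≢j  | yes _  | yes j≡i = ⊥-elim (i≢j (sym j≡i))
    ... | yes ij | _       | no ji  | _       = ⊥-elim (ji (sym ij))
    ... | no ij  | _       | yes ji | _       = ⊥-elim (ij (sym ji))
    ... | no _   | _       | no _   | _       = refl

    colour-irrefl : ∀ i → colour i i ≡ nothing
    colour-irrefl i with blk i ≟ℕ blk i | i ≟ i
    ... | yes _ | yes _   = refl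
    ... | yes _ | no i≢i  = ⊥-elim (i≢i refl)
    ... | no _  | _       = refl

    G : ColouredGraph n
    G = record { col = colour ; sym = colour-sym ; irrefl = colour-irrefl }

    colour≡just⇒ : ∀ {i j c} → colour i j ≡ just c →
                   blk i ≡ blk j × ∃ λ ab → label ∣ toℕ i - toℕ j ∣ ≡ just ab × c ≡ code (blk i) ab
    colour≡just⇒ {i} {j} eq with blk i ≟ℕ blk j | i ≟ j
    ... | yes ij | no _ with label ∣ toℕ i - toℕ j ∣ | eq
    ...   | just ab | refl = ij , ab , refl , refl

    colour-in-block : ∀ {i j} → blk i ≡ blk j → i ≢ j →
                      colour i j ≡ mapMaybe (code (blk i)) (label ∣ toℕ i - toℕ j ∣)
    colour-in-block {i} {j} ij i≢j with blk i ≟ℕ blk j | i ≟ j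
    ... | yes _ | no _    = refl
    ... | yes _ | yes i≡j = ⊥-elim (i≢j i≡j)
    ... | no ij≢  | _     = ⊥-elim (ij≢ ij)

    numEdges-≤ : numEdges G ≤ (M + M) * n
    numEdges-≤ = sumFin-≤-* _ (M + M) λ i → begin
      count (λ j → does (toℕ i <? toℕ j) ∧ is-just (colour i j))
        ≤⟨ count-≤-∸ (suc (toℕ i)) ((M + M) + toℕ i) _ (later-neighbour i) ⟩
      (M + M) + toℕ i ∸ suc (toℕ i)
        ≤⟨ ∸-monoʳ-≤ ((M + M) + toℕ i) (n≤1+n (toℕ i)) ⟩
      (M + M) + toℕ i ∸ toℕ i
        ≡⟨ m+n∸n≡m (M + M) (toℕ i) ⟩
      M + M
        ∎
      where
      open ≤-Reasoning
      later-neighbour : ∀ i j → (does (toℕ i <? toℕ j) ∧ is-just (colour i j)) ≡ true →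
                        suc (toℕ i) ≤ toℕ j × toℕ j < (M + M) + toℕ i
      later-neighbour i j later with toℕ i <ᵇ toℕ j in i<ᵇj | colour i j in ij
      later-neighbour i j refl | true | just _ =
        <ᵇ⇒< (toℕ i) (toℕ j) (subst T (sym i<ᵇj) _) , block≡⇒< (proj₁ (colour≡just⇒ ij))

    module _ (connected : Connected H) (R : RainbowCopy H G) where
      open RainbowCopy R

      walk-block : ∀ {u v} → Walk H u v → blk (φ v) ≡ blk (φ u)
      walk-block here = refl
      walk-block (step {u} {w} uw rest) =
        trans (walk-block rest) (sym (proj₁ (colour≡just⇒ (proj₂ (edges u w uw)))))

      c₀ : ℕ
      c₀ = blk (φ ℓ)

      -- The fallback (u , v) is never used: the image of an edge of H always carries a label.
      ψ : Vertex × Vertex → Vertex × Vertex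
      ψ (u , v) = fromMaybe (u , v) (label ∣ toℕ (φ u) - toℕ (φ v) ∣)

      ψ-colour : ∀ {u v} → adj H u v ≡ true →
                 uncurry InnerEdge (ψ (u , v)) × col G (φ u) (φ v) ≡ just (code c₀ (ψ (u , v)))
      ψ-colour {u} {v} uv with edges u v uv
      ... | c , φuv≡c with colour≡just⇒ φuv≡c
      ...   | _ , ab , label≡ab , c≡code rewrite label≡ab =
        label-inner _ label≡ab ,
        trans φuv≡c (cong just (trans c≡code (cong (λ b → code b ab) (walk-block (connected ℓ u)))))

      ψ-injective : ∀ {e e′} → uncurry Edge e → uncurry Edge e′ → ψ e ≡ ψ e′ → e ≡ e′
      ψ-injective {u , v} {u′ , v′} uv u′v′ ψe≡ψe′ =
        Edge-SamePair⇒≡ uv u′v′ (rainbow u v u′ v′ _ (proj₂ uv) (proj₂ u′v′)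
          (proj₂ (ψ-colour (proj₂ uv)))
          (trans (proj₂ (ψ-colour (proj₂ u′v′))) (cong (just ∘ code c₀) (sym ψe≡ψe′))))

      ψ-inner : ∀ {e} → uncurry Edge e → uncurry InnerEdge (ψ e)
      ψ-inner (_ , uv) = proj₁ (ψ-colour uv)

      ψ-never-returns : ∀ {e₀} → uncurry Edge e₀ → (∀ {e} → uncurry Edge e → ψ e ≢ e₀) → ⊥
      ψ-never-returns = dedekind-finite (uncurry combine) combine-injective₂
                                        (uncurry Edge) ψ (proj₁ ∘ ψ-inner) ψ-injective

      -- ψ injects the edges of H into its inner edges, so it cannot reach the leaf edge.
      no-rainbow : ⊥
      no-rainbow with edge-sorted ℓp
      ... | inj₁ ℓp-edge = ψ-never-returns ℓp-edge (λ e → proj₁ (proj₂ (ψ-inner e)) ∘ cong proj₁)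
      ... | inj₂ pℓ-edge = ψ-never-returns pℓ-edge (λ e → proj₂ (proj₂ (ψ-inner e)) ∘ cong proj₂)

    record Placement (z : Fin n) : Set where
      field
        σ          : Vertex → Fin n
        σ-p        : σ p ≡ z
        σ-block    : ∀ v → blk (σ v) ≡ blk z
        σ-distance : ∀ u v → ∣ toℕ (σ u) - toℕ (σ v) ∣ ≡ ∣ offset u - offset v ∣

      σ-injective : ∀ {u v} → σ u ≡ σ v → u ≡ v
      σ-injective {u} {v} σu≡σv = offset-injective (∣m-n∣≡0⇒m≡n (begin
        ∣ offset u - offset v ∣        ≡⟨ σ-distance u v ⟨
        ∣ toℕ (σ u) - toℕ (σ v) ∣      ≡⟨ cong (λ i → ∣ toℕ i - toℕ (σ v) ∣) σu≡σv ⟩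
        ∣ toℕ (σ v) - toℕ (σ v) ∣      ≡⟨ ∣n-n∣≡0 (toℕ (σ v)) ⟩
        0                              ∎))
        where open ≡-Reasoning

      σ-avoids : ∀ {w} → blk z ≢ blk w → ∀ v → σ v ≢ w
      σ-avoids z≁w v refl = z≁w (sym (σ-block v))

    placement : M ≤ n → ∀ z → Placement z
    placement M≤n z = record
      { σ          = σ
      ; σ-p        = toℕ-injective (trans (toℕ-σ p) (trans (cong point offset-p) point-0))
      ; σ-block    = λ v → trans (cong block (toℕ-σ v)) (point-block (offset-≤ v))
      ; σ-distance = λ u v →
          trans (cong₂ ∣_-_∣ (toℕ-σ u) (toℕ-σ v)) (point-isometric (offset-≤ u) (offset-≤ v))
      }
      where
      open Ray (ray M≤n (toℕ<n z))
      σ : Vertex → Fin n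
      σ v = fromℕ< (point-< (offset-≤ v))
      toℕ-σ : ∀ v → toℕ (σ v) ≡ point (offset v)
      toℕ-σ v = toℕ-fromℕ< (point-< (offset-≤ v))

    -- H is embedded with p ↦ z, ℓ ↦ w and the other vertices placed in the block of z, so
    -- that the new edge wz (colour k) is the image of the leaf edge and no other.
    module Extension (G′ : ColouredGraph n) {w z : Fin n} {k : ℕ}
                     (wz≡k : col G′ w z ≡ just k)
                     (agrees : ∀ {a b} → a ≢ w → b ≢ w → col G′ a b ≡ colour a b)
                     (P : Placement z)
                     (σ-avoids-w : ∀ {v} → v ≢ ℓ → Placement.σ P v ≢ w)
                     (k-elsewhere : HasInnerEdge → k / B ≢ blk z) where

      open Placement P

      φ : Vertex → Fin n
      φ v with v ≟ ℓ
      ... | yes _ = w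
      ... | no  _ = σ v

      φ-ℓ : φ ℓ ≡ w
      φ-ℓ with ℓ ≟ ℓ
      ... | yes _   = refl
      ... | no  ℓ≢ℓ = ⊥-elim (ℓ≢ℓ refl)

      φ-inner : ∀ {v} → v ≢ ℓ → φ v ≡ σ v
      φ-inner {v} v≢ℓ with v ≟ ℓ
      ... | yes v≡ℓ = ⊥-elim (v≢ℓ v≡ℓ)
      ... | no  _   = refl

      φ-injective : ∀ {u v} → φ u ≡ φ v → u ≡ v
      φ-injective {u} {v} φu≡φv with u ≟ ℓ | v ≟ ℓ
      ... | yes u≡ℓ | yes v≡ℓ = trans u≡ℓ (sym v≡ℓ)
      ... | yes _   | no  v≢ℓ = ⊥-elim (σ-avoids-w v≢ℓ (sym φu≡φv))
      ... | no  u≢ℓ | yes _   = ⊥-elim (σ-avoids-w u≢ℓ φu≡φv)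
      ... | no  _   | no  _   = σ-injective φu≡φv

      leaf-colour : ∀ {u v} → SamePair u v ℓ p → col G′ (φ u) (φ v) ≡ just k
      leaf-colour (inj₁ (refl , refl)) = ℓp-colour
        where
        ℓp-colour : col G′ (φ ℓ) (φ p) ≡ just k
        ℓp-colour rewrite φ-ℓ | φ-inner p≢ℓ | σ-p = wz≡k
      leaf-colour (inj₂ (refl , refl)) =
        trans (ColouredGraph.sym G′ (φ p) (φ ℓ)) (leaf-colour (inj₁ (refl , refl)))

      inner-colour : ∀ {u v} → u ≢ ℓ → v ≢ ℓ → adj H u v ≡ true →
                     ∃₂ λ a b → InnerEdge a b × col G′ (φ u) (φ v) ≡ just (code (blk z) (a , b)) ×
                                ∣ offset a - offset b ∣ ≡ ∣ offset u - offset v ∣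
      inner-colour {u} {v} u≢ℓ v≢ℓ uv with label-realised u≢ℓ v≢ℓ uv
      ... | a , b , label≡ab , ab≡uv = a , b , label-inner _ label≡ab , φuv≡code , ab≡uv
        where
        open ≡-Reasoning
        φuv≡code : col G′ (φ u) (φ v) ≡ just (code (blk z) (a , b))
        φuv≡code = begin
          col G′ (φ u) (φ v)
            ≡⟨ cong₂ (col G′) (φ-inner u≢ℓ) (φ-inner v≢ℓ) ⟩
          col G′ (σ u) (σ v)
            ≡⟨ agrees (σ-avoids-w u≢ℓ) (σ-avoids-w v≢ℓ) ⟩
          colour (σ u) (σ v)
            ≡⟨ colour-in-block (trans (σ-block u) (sym (σ-block v))) (adj-irrefl uv ∘ σ-injective) ⟩
          mapMaybe (code (blk (σ u))) (label ∣ toℕ (σ u) - toℕ (σ v) ∣)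
            ≡⟨ cong₂ (λ c d → mapMaybe (code c) (label d)) (σ-block u) (σ-distance u v) ⟩
          mapMaybe (code (blk z)) (label ∣ offset u - offset v ∣)
            ≡⟨ cong (mapMaybe (code (blk z))) label≡ab ⟩
          just (code (blk z) (a , b))
            ∎

      edge-kind : ∀ {u v} → adj H u v ≡ true → SamePair u v ℓ p ⊎ (u ≢ ℓ × v ≢ ℓ)
      edge-kind {u} {v} uv with u ≟ ℓ | v ≟ ℓ
      ... | yes refl | _        = inj₁ (inj₁ (refl , ℓ-leaf v uv))
      ... | no  _    | yes refl = inj₁ (inj₂ (ℓ-leaf u (adj-sym uv) , refl))
      ... | no  u≢ℓ  | no  v≢ℓ  = inj₂ (u≢ℓ , v≢ℓ)

      leaf≢inner : ∀ {u v u′ v′} → SamePair u v ℓ p →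
                   u′ ≢ ℓ → v′ ≢ ℓ → adj H u′ v′ ≡ true →
                   col G′ (φ u) (φ v) ≢ col G′ (φ u′) (φ v′)
      leaf≢inner leaf u′≢ℓ v′≢ℓ u′v′ same
        with a , b , ab , φu′v′≡code , _ ← inner-colour u′≢ℓ v′≢ℓ u′v′ =
        k-elsewhere (a , b , ab) (begin
          k / B                      ≡⟨ cong (_/ B) (just-injective k≡code) ⟩
          code (blk z) (a , b) / B   ≡⟨ code-block (blk z) (a , b) ⟩
          blk z                      ∎)
        where
        open ≡-Reasoning
        k≡code : just k ≡ just (code (blk z) (a , b))
        k≡code = trans (sym (leaf-colour leaf)) (trans same φu′v′≡code)

      inner≡inner : ∀ {u v u′ v′} → u ≢ ℓ → v ≢ ℓ → adj H u v ≡ true →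
                    u′ ≢ ℓ → v′ ≢ ℓ → adj H u′ v′ ≡ true →
                    col G′ (φ u) (φ v) ≡ col G′ (φ u′) (φ v′) → SamePair u v u′ v′
      inner≡inner u≢ℓ v≢ℓ uv u′≢ℓ v′≢ℓ u′v′ same
        with a , b , _ , uv≡code , ab≡uv ← inner-colour u≢ℓ v≢ℓ uv
           | a′ , b′ , _ , u′v′≡code , a′b′≡u′v′ ← inner-colour u′≢ℓ v′≢ℓ u′v′
        with refl ← code-injective (blk z) {a , b} {a′ , b′}
                      (just-injective (trans (sym uv≡code) (trans same u′v′≡code)))
        = offset-sidon (adj-irrefl uv) (adj-irrefl u′v′) (trans (sym ab≡uv) a′b′≡u′v′)

      same-colour⇒SamePair : ∀ {u v u′ v′} → adj H u v ≡ true → adj H u′ v′ ≡ true →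
                             col G′ (φ u) (φ v) ≡ col G′ (φ u′) (φ v′) → SamePair u v u′ v′
      same-colour⇒SamePair uv u′v′ same with edge-kind uv | edge-kind u′v′
      ... | inj₁ leaf      | inj₁ leaf′       = SamePair-trans leaf (SamePair-sym leaf′)
      ... | inj₁ leaf      | inj₂ (u′ℓ , v′ℓ) = ⊥-elim (leaf≢inner leaf u′ℓ v′ℓ u′v′ same)
      ... | inj₂ (uℓ , vℓ) | inj₁ leaf′       = ⊥-elim (leaf≢inner leaf′ uℓ vℓ uv (sym same))
      ... | inj₂ (uℓ , vℓ) | inj₂ (u′ℓ , v′ℓ) = inner≡inner uℓ vℓ uv u′ℓ v′ℓ u′v′ same

      rainbow : ∀ u v u′ v′ c → adj H u v ≡ true → adj H u′ v′ ≡ true →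
                col G′ (φ u) (φ v) ≡ just c → col G′ (φ u′) (φ v′) ≡ just c → SamePair u v u′ v′
      rainbow _ _ _ _ _ uv u′v′ uv≡c u′v′≡c =
        same-colour⇒SamePair uv u′v′ (trans uv≡c (sym u′v′≡c))

      edges : ∀ u v → adj H u v ≡ true → ∃ λ c → col G′ (φ u) (φ v) ≡ just c
      edges u v uv with edge-kind uv
      ... | inj₁ leaf             = k , leaf-colour leaf
      ... | inj₂ (u≢ℓ , v≢ℓ) with _ , _ , _ , uv≡code , _ ← inner-colour u≢ℓ v≢ℓ uv = _ , uv≡code

      copy : RainbowCopy H G′
      copy = record { φ = φ ; φ-inj = φ-injective ; edges = edges ; rainbow = rainbow }

    absent⇒blocks-differ : HasInnerEdge → ∀ {x y} → x ≢ y → colour x y ≡ nothing → blk x ≢ blk y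
    absent⇒blocks-differ inner {x} {y} x≢y xy-absent same
      with ab , label≡ab ← label-total inner ∣ toℕ x - toℕ y ∣
      with () ← trans (sym xy-absent)
                  (trans (colour-in-block same x≢y) (cong (mapMaybe (code (blk x))) label≡ab))

    saturated : Connected H → M ≤ n → ∀ x y (x≢y : x ≢ y) → colour x y ≡ nothing → ∀ k →
                RainbowCopy H (addEdge G x y x≢y k)
    saturated connected M≤n x y x≢y xy-absent k with hasInnerEdge?
    ... | no noInner =
      Extension.copy _ (addEdge-new G x≢y k) (addEdge-awayˡ G x≢y k) Py σ-avoids-x (⊥-elim ∘ noInner)
      where
      Py : Placement y
      Py = placement M≤n y
      σ-avoids-x : ∀ {v} → v ≢ ℓ → Placement.σ Py v ≢ x
      σ-avoids-x {v} v≢ℓ σv≡x with ¬HasInnerEdge⇒ℓ-or-p connected noInner v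
      ... | inj₁ v≡ℓ  = v≢ℓ v≡ℓ
      ... | inj₂ refl = x≢y (trans (sym σv≡x) (Placement.σ-p Py))
    ... | yes inner with k / B ≟ℕ blk y
    ...   | yes k-in-y =
      Extension.copy _ yx≡k (addEdge-awayʳ G x≢y k) Px (λ {v} _ → Placement.σ-avoids Px x≁y v)
                     (λ _ k-in-x → x≁y (trans (sym k-in-x) k-in-y))
      where
      Px : Placement x
      Px = placement M≤n x
      x≁y : blk x ≢ blk y
      x≁y = absent⇒blocks-differ inner x≢y xy-absent
      yx≡k : col (addEdge G x y x≢y k) y x ≡ just k
      yx≡k = trans (ColouredGraph.sym (addEdge G x y x≢y k) y x) (addEdge-new G x≢y k)
    ...   | no k-not-in-y =
      Extension.copy _ (addEdge-new G x≢y k) (addEdge-awayˡ G x≢y k) Py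
                     (λ {v} _ → Placement.σ-avoids Py y≁x v) (λ _ → k-not-in-y)
      where
      Py : Placement y
      Py = placement M≤n y
      y≁x : blk y ≢ blk x
      y≁x = absent⇒blocks-differ inner x≢y xy-absent ∘ sym

  rsat-linear : Connected H → RsatLinear H
  rsat-linear connected = (M + M) , M , λ n M≤n →
    Graph.G n , (Graph.no-rainbow n connected , Graph.saturated n connected M≤n) , Graph.numEdges-≤ n

proposition6 : ∀ {h : ℕ} (H : SimpleGraph h) → Connected H → MinDegreeOne H → RsatLinear H
proposition6 {zero}  H connected (_ , () , _)
proposition6 {suc h} H connected (_ , ℓ , deg-ℓ≡1)
  with p , ℓp , ℓ-leaf ← count≡1⇒unique (adj H ℓ) deg-ℓ≡1 =
  Construction.rsat-linear H ℓp ℓ-leaf connected
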